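{- Suppose $\Phi\subseteq\{I,O,U\}$ and let $\mathcal{R}$ be an RBox in $\mathcal{L}_\Phi$. Let $\mathcal{I}_0$ be a model of $\mathcal{R}$, let $Z$ be an $\mathcal{L}_\Phi$-bisimulation between $\mathcal{I}_0$ and an interpretation $\mathcal{I}_1$, and let $\mathcal{I}_1'$ be the least r-extension of $\mathcal{I}_1$ validating $\mathcal{R}$. Then $Z$ is an $\mathcal{L}_\Phi$-bisimulation between $\mathcal{I}_0$ and $\mathcal{I}_1'$.
   Context: Fix finite sets $\Sigma_C,\Sigma_R,\Sigma_I$ of concept, role and individual names. Roles/concepts of $\mathcal{L}_\Phi$: $r\in\Sigma_R$ roles, $A\in\Sigma_C$ concepts; closed under role constructors $\varepsilon, R\circ S, R\sqcup S, R^*, C?$ and concept constructors $\top,\bot,\neg C,C\sqcap D,C\sqcup D,\forall R.C,\exists R.C$; plus $R^-$ if $I\in\Phi$; $\{a\}$ ($a\in\Sigma_I$) if $O\in\Phi$; the role $U$ if $U\in\Phi$. Interpretations $\mathcal{I}$ (nonempty domain; $A^{\mathcal{I}}\subseteq\Delta^{\mathcal{I}}$, $r^{\mathcal{I}}\subseteq(\Delta^{\mathcal{I}})^2$, $a^{\mathcal{I}}\in\Delta^{\mathcal{I}}$) are extended in the standard way (composition, union, reflexive-transitive closure, $(C?)^{\mathcal{I}}=\{(x,x):x\in C^{\mathcal{I}}\}$, $\varepsilon^{\mathcal{I}}$ identity, $U^{\mathcal{I}}=(\Delta^{\mathcal{I}})^2$, inverse, Booleans, $\{a\}^{\mathcal{I}}=\{a^{\mathcal{I}}\}$,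 $\forall,\exists$ as usual). Basic roles: elements of $\Sigma_R\cup\{r^-:r\in\Sigma_R\}$ if $I\in\Phi$, of $\Sigma_R$ otherwise. A role axiom in $\mathcal{L}_\Phi$ is $\varepsilon\sqsubseteq r$ or $R_1\circ\dots\circ R_k\sqsubseteq r$ ($k\ge1$, $R_i$ basic roles, $r\in\Sigma_R$), valid in $\mathcal{I}$ iff $\varepsilon^{\mathcal{I}}\subseteq r^{\mathcal{I}}$, resp. $R_1^{\mathcal{I}}\circ\dots\circ R_k^{\mathcal{I}}\subseteq r^{\mathcal{I}}$. An RBox is a finite set of role axioms; a model validates all of them. $\mathcal{I}'$ is an r-extension of $\mathcal{I}$ if $\Delta^{\mathcal{I}'}=\Delta^{\mathcal{I}}$, $\cdot^{\mathcal{I}'}$ agrees with $\cdot^{\mathcal{I}}$ on concept and individual names, and $r^{\mathcal{I}'}\supseteq r^{\mathcal{I}}$ for all $r\in\Sigma_R$. The least r-extension of $\mathcal{I}$ validating $\mathcal{R}$ is the (unique) r-extension $\mathcal{I}'$ that is a model of $\mathcal{R}$ and satisfies $r^{\mathcal{I}'}\subseteq r^{\mathcal{I}''}$ for all $r$ and every r-extension $\mathcal{I}''$ of $\mathcal{I}$ that is a model of $\mathcal{R}$. $Z\subseteq\Delta^{\mathcal{I}}\times\Delta^{\mathcal{I}'}$ is an $\mathcal{L}_\Phi$-bisimulation (for $\Phi\subseteq\{I,O,U\}$) if for all $a\in\Sigma_I,A\in\Sigma_C,r\in\Sigma_R$, $x,y\in\Delta^{\mathcal{I}}$, $x',y'\in\Delta^{\mathcal{I}'}$: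 (B1) $Z(a^{\mathcal{I}},a^{\mathcal{I}'})$; (B2) $Z(x,x')\Rightarrow(x\in A^{\mathcal{I}}\iff x'\in A^{\mathcal{I}'})$; (B3) $Z(x,x')\wedge(x,y)\in r^{\mathcal{I}}\Rightarrow\exists y'(Z(y,y')\wedge(x',y')\in r^{\mathcal{I}'})$; (B4) $Z(x,x')\wedge(x',y')\in r^{\mathcal{I}'}\Rightarrow\exists y(Z(y,y')\wedge(x,y)\in r^{\mathcal{I}})$; if $I\in\Phi$: (B5) $Z(x,x')\wedge(y,x)\in r^{\mathcal{I}}\Rightarrow\exists y'(Z(y,y')\wedge(y',x')\in r^{\mathcal{I}'})$, (B6) $Z(x,x')\wedge(y',x')\in r^{\mathcal{I}'}\Rightarrow\exists y(Z(y,y')\wedge(y,x)\in r^{\mathcal{I}})$; if $O\in\Phi$: (B7) $Z(x,x')\Rightarrow(x=a^{\mathcal{I}}\iff x'=a^{\mathcal{I}'})$; if $U\in\Phi$: (B10) every $x\in\Delta^{\mathcal{I}}$ is $Z$-related to some $x'$, (B11) every $x'\in\Delta^{\mathcal{I}'}$ is $Z$-related to some $x$. -}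

module Defs where

open import Data.Nat using (ℕ)
open import Data.Fin using (Fin)
open import Data.Bool using (Bool; T)
open import Data.List using (List; []; _∷_)
open import Data.List.Relation.Unary.All using (All)
open import Data.Product using (Σ; _×_; ∃-syntax)
open import Relation.Binary.PropositionalEquality using (_≡_)
open import Function.Bundles using (_⇔_)

record Φ-Set : Set where
  field
    hasI hasO hasU : Bool
open Φ-Set public

record Signature : Set where
  field
    nC nR nI : ℕ
open Signature public

record Interp (S : Signature) (Δ : Set) : Set₁ where
  field
    nonempty : Δ
    conc : Fin (nC S) → Δ → Set
    role : Fin (nR S) → Δ → Δ → Set
    ind  : Fin (nI S) → Δ
open Interp public

data BasicRole (S : Signature) : Set where
  fwd : Fin (nR S) → BasicRole S
  inv : Fin (nR S) → BasicRole S

data BasicRoleIn {S : Signature} (Φ : Φ-Set) : BasicRole S → Set where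
  fwd-in : (r : Fin (nR S)) → BasicRoleIn Φ (fwd r)
  inv-in : (r : Fin (nR S)) → T (hasI Φ) → BasicRoleIn Φ (inv r)

-- Role axioms: ε ⊑ r, or R₁ ∘ R ∘ … ∘ R_k ⊑ r (k ≥ 1: head R₁ plus a list).
data RoleAxiom (S : Signature) : Set where
  ε⊑ : Fin (nR S) → RoleAxiom S
  chain⊑ : BasicRole S → List (BasicRole S) → Fin (nR S) → RoleAxiom S

data RoleAxiomIn {S : Signature} (Φ : Φ-Set) : RoleAxiom S → Set where
  ε-in : (r : Fin (nR S)) → RoleAxiomIn Φ (ε⊑ r)
  chain-in : (R : BasicRole S) (Rs : List (BasicRole S)) (r : Fin (nR S)) →
             BasicRoleIn Φ R → All (BasicRoleIn Φ) Rs → RoleAxiomIn Φ (chain⊑ R Rs r)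

RBox : Signature → Set
RBox S = List (RoleAxiom S)

RBoxIn : {S : Signature} → Φ-Set → RBox S → Set
RBoxIn Φ ℛ = All (RoleAxiomIn Φ) ℛ

⟦_⟧b : {S : Signature} {Δ : Set} → BasicRole S → Interp S Δ → Δ → Δ → Set
⟦ fwd r ⟧b 𝓘 x y = role 𝓘 r x y
⟦ inv r ⟧b 𝓘 x y = role 𝓘 r y x

⟦_∘_⟧c : {S : Signature} {Δ : Set} → BasicRole S → List (BasicRole S) →
         Interp S Δ → Δ → Δ → Set
⟦ R ∘ [] ⟧c 𝓘 x y = ⟦ R ⟧b 𝓘 x y
⟦ R ∘ (R' ∷ Rs) ⟧c 𝓘 x y = ∃[ z ] (⟦ R ⟧b 𝓘 x z × ⟦ R' ∘ Rs ⟧c 𝓘 z y)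

_⊨ax_ : {S : Signature} {Δ : Set} → Interp S Δ → RoleAxiom S → Set
𝓘 ⊨ax ε⊑ r = ∀ x → role 𝓘 r x x
𝓘 ⊨ax chain⊑ R Rs r = ∀ x y → ⟦ R ∘ Rs ⟧c 𝓘 x y → role 𝓘 r x y

_⊨_ : {S : Signature} {Δ : Set} → Interp S Δ → RBox S → Set
𝓘 ⊨ ℛ = All (𝓘 ⊨ax_) ℛ

record IsRExtension {S : Signature} {Δ : Set} (𝓘 𝓘' : Interp S Δ) : Set where
  field
    conc-agree : ∀ A x → conc 𝓘' A x ⇔ conc 𝓘 A x
    ind-agree  : ∀ a → ind 𝓘' a ≡ ind 𝓘 a
    role-ext   : ∀ r x y → role 𝓘 r x y → role 𝓘' r x y

record IsLeastRExtension {S : Signature} {Δ : Set} (ℛ : RBox S) (𝓘 𝓘' : Interp S Δ) : Set₁ where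
  field
    rext  : IsRExtension 𝓘 𝓘'
    model : 𝓘' ⊨ ℛ
    least : (𝓘'' : Interp S Δ) → IsRExtension 𝓘 𝓘'' → 𝓘'' ⊨ ℛ →
            ∀ r x y → role 𝓘' r x y → role 𝓘'' r x y

record IsBisim {S : Signature} {Δ Δ' : Set} (Φ : Φ-Set)
               (𝓘 : Interp S Δ) (𝓘' : Interp S Δ') (Z : Δ → Δ' → Set) : Set where
  field
    B1 : ∀ a → Z (ind 𝓘 a) (ind 𝓘' a)
    B2 : ∀ A x x' → Z x x' → (conc 𝓘 A x ⇔ conc 𝓘' A x')
    B3 : ∀ r x x' y → Z x x' → role 𝓘 r x y → ∃[ y' ] (Z y y' × role 𝓘' r x' y')
    B4 : ∀ r x x' y' → Z x x' → role 𝓘' r x' y' → ∃[ y ] (Z y y' × role 𝓘 r x y)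
    B5 : T (hasI Φ) → ∀ r x x' y → Z x x' → role 𝓘 r y x → ∃[ y' ] (Z y y' × role 𝓘' r y' x')
    B6 : T (hasI Φ) → ∀ r x x' y' → Z x x' → role 𝓘' r y' x' → ∃[ y ] (Z y y' × role 𝓘 r y x)
    B7 : T (hasO Φ) → ∀ a x x' → Z x x' → ((x ≡ ind 𝓘 a) ⇔ (x' ≡ ind 𝓘' a))
    B10 : T (hasU Φ) → ∀ x → ∃[ x' ] Z x x'
    B11 : T (hasU Φ) → ∀ x' → ∃[ x ] Z x x'

module Submission where

-- Leastness of 𝓘₁' reduces the back conditions (B4), (B6) for
-- 𝓘₁' to exhibiting ONE r-extension of 𝓘₁ that is a model of ℛ and whose
-- roles satisfy them by construction.  That interpretation is the
-- reflection of 𝓘₀ along Z: a pair (x', y') is put into r iff every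
-- Z-preimage of x' has an r-successor in 𝓘₀ that is a Z-preimage of y'
-- (and, when I ∈ Φ, symmetrically for r-predecessors of preimages of y').
--   * The pairs "reflected" along Z are closed under composition and
--     contain the diagonal for reflexive relations; hence the reflection
--     of ANY model of an L_Φ-RBox is again a model of it.
--   * For a bisimulation Z, (B4)/(B6) say exactly that the reflection is an
--     r-extension of 𝓘₁; so it contains 𝓘₁' by leastness.
--   * The remaining conditions only speak about individuals, concept names
--     and forward steps, which an r-extension preserves.

open import Defs
open import Data.Bool using (T)
open import Data.List.Relation.Unary.All using (All; []; _∷_; zipWith)
open import Data.Product using (_×_; _,_; proj₁; proj₂; ∃-syntax)
open import Function.Base using (flip)
open import Function.Bundles using (mk⇔; Equivalence)
open import Level using (0ℓ)
open import Relation.Binary.Core using (Rel)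
open import Relation.Binary.PropositionalEquality using (refl; sym; trans; subst)

-- Relational composition; the semantics of a role chain in Defs unfolds to it.
_⨾_ : {Δ : Set} → Rel Δ 0ℓ → Rel Δ 0ℓ → Rel Δ 0ℓ
(P ⨾ Q) x y = ∃[ w ] (P x w × Q w y)

module _ {Δ₀ Δ₁ : Set} (Z : Δ₀ → Δ₁ → Set) where

  Back : Rel Δ₀ 0ℓ → Rel Δ₁ 0ℓ
  Back P x' y' = ∀ x → Z x x' → ∃[ y ] (Z y y' × P x y)

  back-refl : {P : Rel Δ₀ 0ℓ} → (∀ x → P x x) → ∀ x' → Back P x' x'
  back-refl P-refl x' x z = x , z , P-refl x

  back-∘ : {P Q : Rel Δ₀ 0ℓ} → ∀ {x' w' y'} →
           Back P x' w' → Back Q w' y' → Back (P ⨾ Q) x' y'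
  back-∘ P-back Q-back x zx with P-back x zx
  ... | w , zw , Pxw with Q-back w zw
  ...   | y , zy , Qwy = y , zy , (w , Pxw , Qwy)

  back-map : {P Q : Rel Δ₀ 0ℓ} → (∀ x y → P x y → Q x y) →
             ∀ {x' y'} → Back P x' y' → Back Q x' y'
  back-map P⊆Q P-back x zx with P-back x zx
  ... | y , zy , Pxy = y , zy , P⊆Q x y Pxy

  -- With inverses available, a relation must also be reflected backwards.
  Reflected : (inverses : Set) → Rel Δ₀ 0ℓ → Rel Δ₁ 0ℓ
  Reflected inverses P x' y' = Back P x' y' × (inverses → Back (flip P) y' x')

  module _ {inverses : Set} where

    reflected-refl : {P : Rel Δ₀ 0ℓ} → (∀ x → P x x) → ∀ x' → Reflected inverses P x' x'
    reflected-refl P-refl x' = back-refl P-refl x' , λ _ → back-refl P-refl x'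

    -- Backwards, a composite P ⨾ Q is traversed as Q first, then P.
    reflected-∘ : {P Q : Rel Δ₀ 0ℓ} → ∀ {x' w' y'} →
                  Reflected inverses P x' w' → Reflected inverses Q w' y' →
                  Reflected inverses (P ⨾ Q) x' y'
    reflected-∘ (P-fwd , P-bwd) (Q-fwd , Q-bwd) =
      back-∘ P-fwd Q-fwd ,
      λ inv → back-map (λ { y x (w , Qyw , Pwx) → w , Pwx , Qyw })
                       (back-∘ (Q-bwd inv) (P-bwd inv))

    reflected-map : {P Q : Rel Δ₀ 0ℓ} → (∀ x y → P x y → Q x y) →
                    ∀ {x' y'} → Reflected inverses P x' y' → Reflected inverses Q x' y'
    reflected-map P⊆Q (P-fwd , P-bwd) =
      back-map P⊆Q P-fwd , λ inv → back-map (λ y x → P⊆Q x y) (P-bwd inv)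

module _ {S : Signature} (Φ : Φ-Set) {Δ₀ Δ₁ : Set}
         (𝓘₀ : Interp S Δ₀) (𝓘₁ : Interp S Δ₁) (Z : Δ₀ → Δ₁ → Set) where

  reflection : Interp S Δ₁
  reflection = record
    { nonempty = nonempty 𝓘₁
    ; conc     = conc 𝓘₁
    ; role     = λ r → Reflected Z (T (hasI Φ)) (role 𝓘₀ r)
    ; ind      = ind 𝓘₁
    }

  -- Every basic role of L_Φ is interpreted in the reflection by reflected pairs;
  -- an inverse role r⁻ is only allowed when I ∈ Φ, which supplies the backward half.
  reflection-basic : ∀ {R} → BasicRoleIn Φ R →
                     ∀ {x' y'} → ⟦ R ⟧b reflection x' y' →
                     Reflected Z (T (hasI Φ)) (⟦ R ⟧b 𝓘₀) x' y'
  reflection-basic (fwd-in r) reflected = reflected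
  reflection-basic (inv-in r hasI) (r-fwd , r-bwd) = r-bwd hasI , λ _ → r-fwd

  reflection-chain : ∀ {R Rs} → BasicRoleIn Φ R → All (BasicRoleIn Φ) Rs →
                     ∀ {x' y'} → ⟦ R ∘ Rs ⟧c reflection x' y' →
                     Reflected Z (T (hasI Φ)) (⟦ R ∘ Rs ⟧c 𝓘₀) x' y'
  reflection-chain R∈ [] R-step = reflection-basic R∈ R-step
  reflection-chain R∈ (R'∈ ∷ Rs∈) (w' , R-step , rest) =
    reflected-∘ Z (reflection-basic R∈ R-step) (reflection-chain R'∈ Rs∈ rest)

  reflection-model : {ℛ : RBox S} → RBoxIn Φ ℛ → 𝓘₀ ⊨ ℛ → reflection ⊨ ℛ
  reflection-model ℛ∈ 𝓘₀⊨ℛ = zipWith axiom (ℛ∈ , 𝓘₀⊨ℛ)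
    where
    axiom : ∀ {α} → RoleAxiomIn Φ α × 𝓘₀ ⊨ax α → reflection ⊨ax α
    axiom (ε-in r , r-refl) = reflected-refl Z r-refl
    axiom (chain-in R Rs r R∈ Rs∈ , chain⊆r) x' y' chain =
      reflected-map Z chain⊆r (reflection-chain R∈ Rs∈ chain)

  -- The back conditions (B4), (B6) of a bisimulation say precisely that the
  -- reflection contains the roles of 𝓘₁.
  reflection-rext : IsBisim Φ 𝓘₀ 𝓘₁ Z → IsRExtension 𝓘₁ reflection
  reflection-rext bisim = record
    { conc-agree = λ A x → mk⇔ (λ c → c) (λ c → c)
    ; ind-agree  = λ a → refl
    ; role-ext   = λ r x' y' r-step →
        (λ x z → B4 r x x' y' z r-step) , (λ hasI y z → B6 hasI r y y' x' z r-step)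
    }
    where open IsBisim bisim

  bisim-rext : {𝓘₁' : Interp S Δ₁} → IsBisim Φ 𝓘₀ 𝓘₁ Z → IsRExtension 𝓘₁ 𝓘₁' →
               (∀ r x' y' → role 𝓘₁' r x' y' → role reflection r x' y') →
               IsBisim Φ 𝓘₀ 𝓘₁' Z
  bisim-rext bisim rext reflected = record
    { B1 = λ a → subst (Z (ind 𝓘₀ a)) (sym (ind-agree a)) (B1 a)
    ; B2 = λ A x x' z → mk⇔
        (λ c → from (conc-agree A x') (to (B2 A x x' z) c))
        (λ c → from (B2 A x x' z) (to (conc-agree A x') c))
    ; B3 = λ r x x' y z r-step → let (y' , zy , r-step') = B3 r x x' y z r-step
                                 in y' , zy , role-ext r x' y' r-step'
    ; B4 = λ r x x' y' z r-step → proj₁ (reflected r x' y' r-step) x z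
    ; B5 = λ hasI r x x' y z r-step → let (y' , zy , r-step') = B5 hasI r x x' y z r-step
                                      in y' , zy , role-ext r y' x' r-step'
    ; B6 = λ hasI r x x' y' z r-step → proj₂ (reflected r y' x' r-step) hasI x z
    ; B7 = λ hasO a x x' z → mk⇔
        (λ e → trans (to (B7 hasO a x x' z) e) (sym (ind-agree a)))
        (λ e → from (B7 hasO a x x' z) (trans e (ind-agree a)))
    ; B10 = B10
    ; B11 = B11
    }
    where
    open IsBisim bisim
    open IsRExtension rext
    open Equivalence

theorem4 : (S : Signature) (Φ : Φ-Set) (ℛ : RBox S) → RBoxIn Φ ℛ →
           {Δ₀ Δ₁ : Set} (𝓘₀ : Interp S Δ₀) (𝓘₁ 𝓘₁' : Interp S Δ₁) (Z : Δ₀ → Δ₁ → Set) →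
           𝓘₀ ⊨ ℛ → IsBisim Φ 𝓘₀ 𝓘₁ Z → IsLeastRExtension ℛ 𝓘₁ 𝓘₁' →
           IsBisim Φ 𝓘₀ 𝓘₁' Z
theorem4 S Φ ℛ ℛ∈ 𝓘₀ 𝓘₁ 𝓘₁' Z 𝓘₀⊨ℛ bisim least-ext =
  bisim-rext Φ 𝓘₀ 𝓘₁ Z bisim rext
    (least (reflection Φ 𝓘₀ 𝓘₁ Z) (reflection-rext Φ 𝓘₀ 𝓘₁ Z bisim)
           (reflection-model Φ 𝓘₀ 𝓘₁ Z ℛ∈ 𝓘₀⊨ℛ))
  where open IsLeastRExtension least-ext
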